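{- Fix $m,n\geq 2$. If $B$ is an $m\times n$ matrix with integer entries, then $D_1(B)\,D_2^*(B)$ divides $D_1^*(B)\,D_2(B)$.
   Context: For an $m\times n$ integer matrix $B$, $D_k(B)$ is the greatest common divisor of all $k\times k$ minors of $B$, and $D_k^*(B)$ is the greatest common divisor of all $k\times k$ minors of $B$ whose row set contains the last row $m$ and whose column set contains the last column $n$. In particular $D_1(B)$ is the gcd of all entries of $B$ and $D_1^*(B)=b_{m,n}$ (the bottom-right entry). -}

module Defs where

open import Data.Nat using (ℕ; zero; suc; _∸_; _≡ᵇ_)
open import Data.Nat.GCD using (gcd)
open import Data.Integer using (ℤ; +_; -_; _+_; _*_; ∣_∣)
open import Data.Fin using (Fin; zero; suc; toℕ; punchIn)
open import Data.Vec using (Vec; []; _∷_; lookup)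
import Data.Vec as Vec
open import Data.List using (List; []; _∷_; [_]; _++_; map; foldr; filterᵇ; cartesianProduct)
open import Data.Bool using (Bool; true; false; _∨_)
open import Data.Product using (_×_; _,_)

Matrix : ℕ → ℕ → Set
Matrix m n = Fin m → Fin n → ℤ

det : ∀ {k} → Matrix k k → ℤ
det {zero}  M = + 1
det {suc k} M = go (+ 1) (λ j → M zero j) (λ j r c → M (suc r) (punchIn j c))
  where
  go : ∀ {p} → ℤ → (Fin p → ℤ) → (Fin p → Matrix k k) → ℤ
  go {zero}  s row minors = + 0
  go {suc p} s row minors =
    s * row zero * det (minors zero) + go (- s) (λ j → row (suc j)) (λ j → minors (suc j))

-- All strictly increasing k-tuples of indices in Fin m, i.e. all k-subsets of {1..m}.
choose : (k m : ℕ) → List (Vec (Fin m) k)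
choose zero    m       = [ [] ]
choose (suc k) zero    = []
choose (suc k) (suc m) =
  map (λ v → zero ∷ Vec.map suc v) (choose k m) ++ map (Vec.map suc) (choose (suc k) m)

minor : ∀ {m n k} → Matrix m n → Vec (Fin m) k → Vec (Fin n) k → ℤ
minor B rs cs = det (λ a b → B (lookup rs a) (lookup cs b))

IndexSets : ℕ → ℕ → ℕ → Set
IndexSets m n k = Vec (Fin m) k × Vec (Fin n) k

allIndexSets : (m n k : ℕ) → List (IndexSets m n k)
allIndexSets m n k = cartesianProduct (choose k m) (choose k n)

gcdList : List ℤ → ℕ
gcdList = foldr (λ x g → gcd ∣ x ∣ g) 0

-- Does the index set contain the last index (index m, i.e. toℕ ≡ m ∸ 1)?
containsLast : ∀ {m k} → Vec (Fin m) k → Bool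
containsLast {m} v = Vec.foldr _ (λ i b → (toℕ i ≡ᵇ (m ∸ 1)) ∨ b) false v

containsLastBoth : ∀ {m n k} → IndexSets m n k → Bool
containsLastBoth (rs , cs) with containsLast rs
... | true  = containsLast cs
... | false = false

D : ∀ {m n} → ℕ → Matrix m n → ℕ
D {m} {n} k B = gcdList (map (λ { (rs , cs) → minor B rs cs }) (allIndexSets m n k))

D* : ∀ {m n} → ℕ → Matrix m n → ℕ
D* {m} {n} k B =
  gcdList (map (λ { (rs , cs) → minor B rs cs })
               (filterᵇ containsLastBoth (allIndexSets m n k)))

-- Let κ be the bottom-right entry, so D₁* = |κ|, and let M be a 2×2 minor on rows i, k
-- and columns j, l. Each entry y on the border (row m or column n) of the 3×3 submatrix
-- on rows i, k, m and columns j, l, n satisfies a polynomial identity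
-- y·κ·M = Σ ± (entry)·(border entry)·(2×2 minor through the corner), so D₁·D₂*·G divides
-- y·κ·M, where G is the gcd of the border. Hence D₁·D₂*·G divides G·κ·M and G cancels
-- (if G = 0 then κ = 0). Taking the gcd over all M gives D₁·D₂* ∣ κ·D₂.
module Submission where

open import Defs
open import Data.Nat using (ℕ; _*_; _≤_; zero; suc)
open import Data.Nat.Divisibility using (_∣_)
import Data.Nat as ℕ
import Data.Nat.Properties as ℕ
import Data.Nat.Divisibility as ℕ
open import Data.Nat.GCD using (gcd; gcd-greatest; gcd[m,n]∣m; gcd[m,n]∣n; c*gcd[m,n]≡gcd[cm,cn])
open import Data.Integer using (ℤ; +_; _-_; ∣_∣) renaming (_*_ to _·_)
import Data.Integer as ℤ
import Data.Integer.Properties as ℤ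
open import Data.Integer.Divisibility.Signed as ℤ∣
  using (∣ᵤ⇒∣; ∣⇒∣ᵤ; ∣m∣n⇒∣m+n; ∣m∣n⇒∣m-n) renaming (_∣_ to _∣ᶻ_)
open import Data.Integer.Tactic.RingSolver using (solve-∀)
open import Data.Fin using (Fin; zero; suc; toℕ; fromℕ; _<_; _≟_)
open import Data.Fin.Properties using (toℕ-fromℕ; toℕ-injective; ≤fromℕ; ≤∧≢⇒<)
open import Data.Vec using (Vec; []; _∷_)
import Data.Vec as Vec
open import Data.Vec.Membership.Propositional using () renaming (_∈_ to _∈ᵥ_)
open import Data.Vec.Relation.Unary.Any using (here; there)
open import Data.List using (List; []; _∷_; map; filterᵇ)
open import Data.List.Membership.Propositional using (_∈_)
open import Data.List.Relation.Unary.Any using (here; there)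
open import Data.List.Membership.Propositional.Properties
  using (∈-map⁺; ∈-map⁻; ∈-++⁺ˡ; ∈-++⁺ʳ; ∈-filter⁺; ∈-filter⁻; ∈-cartesianProduct⁺)
open import Data.Bool using (T; true; false; _∧_)
open import Data.Bool.Properties using (T-∨; T-∧)
open import Data.Product using (_,_; proj₂)
open import Data.Sum using (inj₁; inj₂)
open import Function using (_∘_; Equivalence)
open import Relation.Nullary using (Dec; yes; no)
open import Relation.Nullary.Decidable using (T?)
open import Relation.Binary.PropositionalEquality

gcdList∣ : ∀ {ys y} → y ∈ ys → gcdList ys ∣ ∣ y ∣
gcdList∣ (here refl) = gcd[m,n]∣m _ _
gcdList∣ {x ∷ _} (there y∈ys) = ℕ.∣-trans (gcd[m,n]∣n ∣ x ∣ _) (gcdList∣ y∈ys)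

∣*gcdList : ∀ {d} w ys → (∀ {y} → y ∈ ys → d ∣ w * ∣ y ∣) → d ∣ w * gcdList ys
∣*gcdList {d} w [] _ = subst (d ∣_) (sym (ℕ.*-zeroʳ w)) (d ℕ.∣0)
∣*gcdList {d} w (x ∷ ys) d∣ =
  subst (d ∣_) (sym (c*gcd[m,n]≡gcd[cm,cn] w ∣ x ∣ (gcdList ys)))
    (gcd-greatest (d∣ (here refl)) (∣*gcdList w ys (λ y∈ys → d∣ (there y∈ys))))

gcdList∣ᶻ : ∀ {ys y} → y ∈ ys → + gcdList ys ∣ᶻ y
gcdList∣ᶻ = ∣ᵤ⇒∣ ∘ gcdList∣

∣·gcdListᶻ : ∀ {δ} z ys → (∀ {y} → y ∈ ys → δ ∣ᶻ z · y) → δ ∣ᶻ z · + gcdList ys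
∣·gcdListᶻ {δ} z ys δ∣ =
  ∣ᵤ⇒∣ (subst (∣ δ ∣ ∣_) (sym (ℤ.abs-* z _))
    (∣*gcdList ∣ z ∣ ys (λ {y} y∈ys → subst (∣ δ ∣ ∣_) (ℤ.abs-* z y) (∣⇒∣ᵤ (δ∣ y∈ys)))))

_∣ᶻ0 : ∀ δ → δ ∣ᶻ + 0
δ ∣ᶻ0 = ∣ᵤ⇒∣ (∣ δ ∣ ℕ.∣0)

*-pres-∣ᶻ : ∀ {i j x y} → i ∣ᶻ x → j ∣ᶻ y → i · j ∣ᶻ x · y
*-pres-∣ᶻ {j = j} {x} i∣x j∣y = ℤ∣.∣-trans (ℤ∣.*-monoˡ-∣ j i∣x) (ℤ∣.*-monoʳ-∣ x j∣y)

singleton∈choose : ∀ {m} (i : Fin m) → (i ∷ []) ∈ choose 1 m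
singleton∈choose {suc m} zero = ∈-++⁺ˡ {ys = map (Vec.map suc) (choose 1 m)} (here refl)
singleton∈choose (suc i)     = ∈-++⁺ʳ _ (∈-map⁺ (Vec.map suc) (singleton∈choose i))

pair∈choose : ∀ {m} {i k : Fin m} → i < k → (i ∷ k ∷ []) ∈ choose 2 m
pair∈choose {i = zero}  {suc k} _         = ∈-++⁺ˡ (∈-map⁺ _ (singleton∈choose k))
pair∈choose {i = suc i} {suc k} (ℕ.s≤s i<k) = ∈-++⁺ʳ _ (∈-map⁺ (Vec.map suc) (pair∈choose i<k))

containsLast⁺ : ∀ {m k} {v : Vec (Fin (suc m)) k} → fromℕ m ∈ᵥ v → T (containsLast v)
containsLast⁺ {m} (here refl) = Equivalence.from T-∨ (inj₁ (ℕ.≡⇒≡ᵇ _ m (toℕ-fromℕ m)))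
containsLast⁺ (there p)       = Equivalence.from T-∨ (inj₂ (containsLast⁺ p))

containsLast-singleton⁻ : ∀ {m} (i : Fin (suc m)) → T (containsLast (i ∷ [])) → i ≡ fromℕ m
containsLast-singleton⁻ {m} i t with Equivalence.to T-∨ t
... | inj₁ toℕi≡m = toℕ-injective (trans (ℕ.≡ᵇ⇒≡ (toℕ i) m toℕi≡m) (sym (toℕ-fromℕ m)))

containsLastBoth≡∧ : ∀ {m n k} (rs : Vec (Fin m) k) (cs : Vec (Fin n) k) →
  containsLastBoth (rs , cs) ≡ containsLast rs ∧ containsLast cs
containsLastBoth≡∧ rs cs with containsLast rs
... | true  = refl
... | false = refl

minor-1×1 : ∀ {m n} (B : Matrix m n) i j → minor B (i ∷ []) (j ∷ []) ≡ B i j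
minor-1×1 B i j = expand (B i j)
  where
  expand : ∀ x → + 1 · x · + 1 ℤ.+ + 0 ≡ x
  expand = solve-∀

minor-2×2 : ∀ {m n} (B : Matrix m n) i k j l →
  minor B (i ∷ k ∷ []) (j ∷ l ∷ []) ≡ B i j · B k l - B i l · B k j
minor-2×2 B i k j l = expand (B i j) (B i l) (B k j) (B k l)
  where
  expand : ∀ a b c d →
    + 1 · a · (+ 1 · d · + 1 ℤ.+ + 0) ℤ.+ (ℤ.- + 1 · b · (+ 1 · c · + 1 ℤ.+ + 0) ℤ.+ + 0) ≡ a · d - b · c
  expand = solve-∀

-- For rows (a b c), (d e f), (u v κ), each border entry c, f, u, v, κ times κ·(a e - b d)
-- is a combination of the four minors a κ - c u, b κ - c v, d κ - f u, e κ - f v through κ.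
expansion-c : ∀ a b c d e f u v κ → κ · (a · e - b · d) · c ≡
  a · (e · κ - f · v) · c - a · (b · κ - c · v) · f - b · (d · κ - f · u) · c ℤ.+ b · (a · κ - c · u) · f
expansion-c = solve-∀

expansion-f : ∀ a b c d e f u v κ → κ · (a · e - b · d) · f ≡
  d · (e · κ - f · v) · c - e · (d · κ - f · u) · c - d · (b · κ - c · v) · f ℤ.+ e · (a · κ - c · u) · f
expansion-f = solve-∀

expansion-u : ∀ a b c d e f u v κ → κ · (a · e - b · d) · u ≡
  a · (e · κ - f · v) · u - a · (d · κ - f · u) · v - d · (b · κ - c · v) · u ℤ.+ d · (a · κ - c · u) · v
expansion-u = solve-∀

expansion-v : ∀ a b c d e f u v κ → κ · (a · e - b · d) · v ≡
  b · (e · κ - f · v) · u - b · (d · κ - f · u) · v - e · (b · κ - c · v) · u ℤ.+ e · (a · κ - c · u) · v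
expansion-v = solve-∀

expansion-κ : ∀ a b c d e f u v κ → κ · (a · e - b · d) · κ ≡
  u · (e · κ - f · v) · c - v · (d · κ - f · u) · c - d · (b · κ - c · v) · κ ℤ.+ e · (a · κ - c · u) · κ
expansion-κ = solve-∀

module _ {m n : ℕ} (B : Matrix (suc m) (suc n)) where

  κ : ℤ
  κ = B (fromℕ m) (fromℕ n)

  minorAt : ∀ {k} → IndexSets (suc m) (suc n) k → ℤ
  minorAt (rs , cs) = minor B rs cs

  minors : ∀ {k} → List (IndexSets (suc m) (suc n) k) → List ℤ
  minors = map minorAt

  minor₂ : Fin (suc m) → Fin (suc m) → Fin (suc n) → Fin (suc n) → ℤ
  minor₂ i k j l = B i j · B k l - B i l · B k j

  border : Fin (suc m) → Fin (suc m) → Fin (suc n) → Fin (suc n) → List ℤ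
  border i k j l = B i (fromℕ n) ∷ B k (fromℕ n) ∷ B (fromℕ m) j ∷ B (fromℕ m) l ∷ κ ∷ []

  module _ {γ σ : ℤ} (γ∣ : ∀ r c → γ ∣ᶻ B r c) (σ∣ : ∀ r c → σ ∣ᶻ minor₂ r (fromℕ m) c (fromℕ n))
           (i k : Fin (suc m)) (j l : Fin (suc n)) where

    private
      a b c d e f u v γσG : ℤ
      a = B i j
      b = B i l
      c = B i (fromℕ n)
      d = B k j
      e = B k l
      f = B k (fromℕ n)
      u = B (fromℕ m) j
      v = B (fromℕ m) l
      γσG = γ · σ · + gcdList (border i k j l)

      c∈ : c ∈ border i k j l
      c∈ = here refl
      f∈ : f ∈ border i k j l
      f∈ = there (here refl)
      u∈ : u ∈ border i k j l
      u∈ = there (there (here refl))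
      v∈ : v ∈ border i k j l
      v∈ = there (there (there (here refl)))
      κ∈ : κ ∈ border i k j l
      κ∈ = there (there (there (there (here refl))))

      term : ∀ {p x r} → γ ∣ᶻ p → σ ∣ᶻ x → r ∈ border i k j l → γσG ∣ᶻ p · x · r
      term γ∣p σ∣x r∈ = *-pres-∣ᶻ (*-pres-∣ᶻ γ∣p σ∣x) (gcdList∣ᶻ r∈)

      combine : ∀ {t₁ t₂ t₃ t₄} → γσG ∣ᶻ t₁ → γσG ∣ᶻ t₂ → γσG ∣ᶻ t₃ → γσG ∣ᶻ t₄ →
        γσG ∣ᶻ t₁ - t₂ - t₃ ℤ.+ t₄
      combine d₁ d₂ d₃ d₄ = ∣m∣n⇒∣m+n (∣m∣n⇒∣m-n (∣m∣n⇒∣m-n d₁ d₂) d₃) d₄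

    border·κ·minor-divisible : ∀ {y} → y ∈ border i k j l →
      γ · σ · + gcdList (border i k j l) ∣ᶻ κ · minor₂ i k j l · y
    border·κ·minor-divisible (here refl) =
      subst (γσG ∣ᶻ_) (sym (expansion-c a b c d e f u v κ))
      (combine (term (γ∣ i j) (σ∣ k l) c∈) (term (γ∣ i j) (σ∣ i l) f∈)
               (term (γ∣ i l) (σ∣ k j) c∈) (term (γ∣ i l) (σ∣ i j) f∈))
    border·κ·minor-divisible (there (here refl)) =
      subst (γσG ∣ᶻ_) (sym (expansion-f a b c d e f u v κ))
      (combine (term (γ∣ k j) (σ∣ k l) c∈) (term (γ∣ k l) (σ∣ k j) c∈)
               (term (γ∣ k j) (σ∣ i l) f∈) (term (γ∣ k l) (σ∣ i j) f∈))
    border·κ·minor-divisible (there (there (here refl))) =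
      subst (γσG ∣ᶻ_) (sym (expansion-u a b c d e f u v κ))
      (combine (term (γ∣ i j) (σ∣ k l) u∈) (term (γ∣ i j) (σ∣ k j) v∈)
               (term (γ∣ k j) (σ∣ i l) u∈) (term (γ∣ k j) (σ∣ i j) v∈))
    border·κ·minor-divisible (there (there (there (here refl)))) =
      subst (γσG ∣ᶻ_) (sym (expansion-v a b c d e f u v κ))
      (combine (term (γ∣ i l) (σ∣ k l) u∈) (term (γ∣ i l) (σ∣ k j) v∈)
               (term (γ∣ k l) (σ∣ i l) u∈) (term (γ∣ k l) (σ∣ i j) v∈))
    border·κ·minor-divisible (there (there (there (there (here refl))))) =
      subst (γσG ∣ᶻ_) (sym (expansion-κ a b c d e f u v κ))
      (combine (term (γ∣ (fromℕ m) j) (σ∣ k l) c∈) (term (γ∣ (fromℕ m) l) (σ∣ k j) c∈)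
               (term (γ∣ k j) (σ∣ i l) κ∈) (term (γ∣ k l) (σ∣ i j) κ∈))

    κ·minor-divisible : γ · σ ∣ᶻ κ · minor₂ i k j l
    κ·minor-divisible = cancel (gcdList (border i k j l) ℕ.≟ 0)
      where
      cancel : Dec (gcdList (border i k j l) ≡ 0) → γ · σ ∣ᶻ κ · minor₂ i k j l
      cancel (yes G≡0) = subst (λ x → γ · σ ∣ᶻ x · minor₂ i k j l) (sym κ≡0) ((γ · σ) ∣ᶻ0)
        where
        κ≡0 : κ ≡ + 0
        κ≡0 = ℤ.∣i∣≡0⇒i≡0 (ℕ.0∣⇒≡0 (subst (_∣ ∣ κ ∣) G≡0 (gcdList∣ κ∈)))
      cancel (no G≢0) = ℤ∣.*-cancelʳ-∣ (+ gcdList (border i k j l)) {{ℕ.≢-nonZero G≢0}}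
        (∣·gcdListᶻ (κ · minor₂ i k j l) (border i k j l) border·κ·minor-divisible)

  D₁∣entry : ∀ r c → + D 1 B ∣ᶻ B r c
  D₁∣entry r c = subst (+ D 1 B ∣ᶻ_) (minor-1×1 B r c)
    (gcdList∣ᶻ (∈-map⁺ minorAt (∈-cartesianProduct⁺ (singleton∈choose r) (singleton∈choose c))))

  D*₂∣corner-minor₂ : ∀ r c → + D* 2 B ∣ᶻ minor₂ r (fromℕ m) c (fromℕ n)
  D*₂∣corner-minor₂ r c with r ≟ fromℕ m | c ≟ fromℕ n
  ... | yes refl | _ = subst (+ D* 2 B ∣ᶻ_) (sym (commutator≡0 (B r c) κ)) ((+ D* 2 B) ∣ᶻ0)
    where
    commutator≡0 : ∀ x y → x · y - y · x ≡ + 0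
    commutator≡0 = solve-∀
  ... | no _ | yes refl = subst (+ D* 2 B ∣ᶻ_) (sym (ℤ.+-inverseʳ (B r c · κ))) ((+ D* 2 B) ∣ᶻ0)
  ... | no r≢last | no c≢last = subst (+ D* 2 B ∣ᶻ_) (minor-2×2 B r (fromℕ m) c (fromℕ n))
    (gcdList∣ᶻ (∈-map⁺ minorAt (∈-filter⁺ (T? ∘ containsLastBoth) indexSets∈ throughCorner)))
    where
    indexSets∈ : (r ∷ fromℕ m ∷ [] , c ∷ fromℕ n ∷ []) ∈ allIndexSets (suc m) (suc n) 2
    indexSets∈ = ∈-cartesianProduct⁺ (pair∈choose (≤∧≢⇒< (≤fromℕ r) r≢last))
                                     (pair∈choose (≤∧≢⇒< (≤fromℕ c) c≢last))
    throughCorner : T (containsLastBoth (r ∷ fromℕ m ∷ [] , c ∷ fromℕ n ∷ []))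
    throughCorner = subst T (sym (containsLastBoth≡∧ (r ∷ fromℕ m ∷ []) (c ∷ fromℕ n ∷ [])))
      (Equivalence.from T-∧ (containsLast⁺ {v = r ∷ fromℕ m ∷ []} (there (here refl)) ,
                             containsLast⁺ {v = c ∷ fromℕ n ∷ []} (there (here refl))))

  κ∣D*₁ : κ ∣ᶻ + D* 1 B
  κ∣D*₁ = subst (κ ∣ᶻ_) (ℤ.*-identityˡ _)
    (∣·gcdListᶻ (+ 1) (minors throughCorner₁) (λ y∈ → ℤ∣.∣n⇒∣m*n (+ 1) (ℤ∣.∣-reflexive (κ≡ y∈))))
    where
    throughCorner₁ : List (IndexSets (suc m) (suc n) 1)
    throughCorner₁ = filterᵇ containsLastBoth (allIndexSets (suc m) (suc n) 1)

    κ≡minor : ∀ i j → T (containsLastBoth (i ∷ [] , j ∷ [])) → κ ≡ minor B (i ∷ []) (j ∷ [])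
    κ≡minor i j through with Equivalence.to T-∧ (subst T (containsLastBoth≡∧ (i ∷ []) (j ∷ [])) through)
    ... | i-last , j-last = begin
      κ                         ≡⟨ cong₂ B (containsLast-singleton⁻ i i-last) (containsLast-singleton⁻ j j-last) ⟨
      B i j                     ≡⟨ minor-1×1 B i j ⟨
      minor B (i ∷ []) (j ∷ []) ∎
      where open ≡-Reasoning

    κ≡ : ∀ {y} → y ∈ minors throughCorner₁ → κ ≡ y
    κ≡ y∈ with ∈-map⁻ minorAt y∈
    ... | (i ∷ [] , j ∷ []) , mem , refl =
      κ≡minor i j (proj₂ (∈-filter⁻ (T? ∘ containsLastBoth) {xs = allIndexSets (suc m) (suc n) 1} mem))

  D₁D*₂∣κD₂ : + D 1 B · + D* 2 B ∣ᶻ κ · + D 2 B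
  D₁D*₂∣κD₂ = ∣·gcdListᶻ κ (minors (allIndexSets (suc m) (suc n) 2)) κ·minor∈
    where
    κ·minor∈ : ∀ {y} → y ∈ minors (allIndexSets (suc m) (suc n) 2) →
      + D 1 B · + D* 2 B ∣ᶻ κ · y
    κ·minor∈ y∈ with ∈-map⁻ minorAt y∈
    ... | (i ∷ k ∷ [] , j ∷ l ∷ []) , _ , refl =
      subst (λ x → + D 1 B · + D* 2 B ∣ᶻ κ · x) (sym (minor-2×2 B i k j l))
        (κ·minor-divisible D₁∣entry D*₂∣corner-minor₂ i k j l)

proposition3p5 : (m n : ℕ) → 2 ≤ m → 2 ≤ n → (B : Matrix m n) →
    D 1 B * D* 2 B ∣ D* 1 B * D 2 B
proposition3p5 (suc m) (suc n) _ _ B =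
  ∣⇒∣ᵤ (subst₂ _∣ᶻ_ (sym (ℤ.pos-* (D 1 B) (D* 2 B))) (sym (ℤ.pos-* (D* 1 B) (D 2 B)))
    (ℤ∣.∣-trans (D₁D*₂∣κD₂ B) (ℤ∣.*-monoˡ-∣ (+ D 2 B) (κ∣D*₁ B))))
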